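{- Let $(G,<)$ be a Latin instance with $G=(A\cup B,E)$, and let $(G',<')$ be the auxiliary instance constructed from it as described below. Then $|\mathcal{S}(G',<')|=1$, and in this unique stable matching each man $a\in A$ is matched to his second least favorite partner with respect to $<'$.
   Context: A stable marriage instance $(G,<)$: $G=(A\cup B,E)$ finite simple bipartite graph (men $A$, women $B$), $<_v$ a strict total order on the neighbours of $v$. A matching has each vertex in at most one edge; $M(x)$ is the partner or $\emptyset$ (ranked below all neighbours). Edge $ab$ blocks $M$ if $b>_a M(a)$ and $a>_b M(b)$; $M$ is stable if no edge blocks it; $\mathcal{S}(G,<)$ is the set of stable matchings. For complete lists ($G$ complete bipartite, $|A|=|B|=n$), the rank of $a$ in $b$'s list is its position (1 = most preferred). $(G,<)$ is Latin if there is an $n\times n$ Latin square $Q$, rows indexed by $A$, columns by $B$, with $Q(a,b)$ the rank of $b$ in $a$'s list and $n+1-Q(a,b)$ the rank of $a$ in $b$'s list. Auxiliary instance $(G',<')$: $A'=A\cup\{\tilde a\}$, $B'=B\cup\{\tilde b\}$, $G'$ complete bipartite on $A'\cup B'$, and (i) every $a\in A$ ranks $\tilde b$ last and ranks $B$ as in $<_a$; (ii) $\tilde a$ has an arbitrary ranking of $B'$ with $\tilde b$ last; (iii) every $b\in B$ ranks $\tilde a$ in the second position and ranks $A$ as in $<_b$; (iv) $\tilde b$ has an arbitrary ranking of $A'$ with $\tilde a$ first. -}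

module Defs where

open import Data.Nat using (ℕ; suc; _+_; _∸_)
open import Data.Fin using (Fin; zero; toℕ; inject₁; fromℕ; _<_)
open import Data.Maybe using (Maybe; just; nothing)
open import Data.Product using (Σ; ∃; ∃-syntax; _×_; _,_)
open import Data.Sum using (_⊎_)
open import Relation.Binary.PropositionalEquality using (_≡_; _≢_)
open import Relation.Nullary using (¬_)
open import Function.Definitions using (Injective)

-- A stable marriage instance with complete preference lists on a complete
-- bipartite graph with k men (Fin k) and k women (Fin k).
-- Strict total orders are given by rank functions (positions, 0-based:
-- 0 = most preferred); each list is a permutation (injective Fin k → Fin k).
record Instance (k : ℕ) : Set where
  field
    rankM    : Fin k → Fin k → Fin k   -- rankM a b = position of woman b in man a's list
    rankW    : Fin k → Fin k → Fin k   -- rankW b a = position of man a in woman b's list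
    rankM-inj : ∀ a → Injective _≡_ _≡_ (rankM a)
    rankW-inj : ∀ b → Injective _≡_ _≡_ (rankW b)

open Instance public

record Matching (k : ℕ) : Set where
  field
    partner : Fin k → Maybe (Fin k)
    partner-inj : ∀ a a' b → partner a ≡ just b → partner a' ≡ just b → a ≡ a'

open Matching public

-- man a strictly prefers woman b to M(a) (∅ is ranked below everybody)
ManPrefers : ∀ {k} → Instance k → Matching k → Fin k → Fin k → Set
ManPrefers {k} I M a b =
  partner M a ≡ nothing
  ⊎ Σ (Fin k) λ b' → partner M a ≡ just b' × rankM I a b < rankM I a b'

WomanPrefers : ∀ {k} → Instance k → Matching k → Fin k → Fin k → Set
WomanPrefers {k} I M a b =
  (∀ a' → partner M a' ≢ just b)
  ⊎ Σ (Fin k) λ a' → partner M a' ≡ just b × rankW I b a < rankW I b a'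

Blocks : ∀ {k} → Instance k → Matching k → Fin k → Fin k → Set
Blocks I M a b = ManPrefers I M a b × WomanPrefers I M a b

Stable : ∀ {k} → Instance k → Matching k → Set
Stable I M = ∀ a b → ¬ Blocks I M a b

-- n × n Latin square with symbols Fin n (symbol i stands for i+1):
-- each row and each column is a permutation.
LatinSquare : ∀ {n} → (Fin n → Fin n → Fin n) → Set
LatinSquare {n} Q =
  (∀ a → Injective _≡_ _≡_ (λ b → Q a b)) × (∀ b → Injective _≡_ _≡_ (λ a → Q a b))

-- Latin instance: rank (1-based) of b in a's list is Q(a,b) and rank of a in
-- b's list is n+1-Q(a,b). In 0-based terms: rankM a b = Q a b and
-- rankW b a + Q a b + 1 = n.
IsLatin : ∀ {n} → Instance n → Set
IsLatin {n} I = Σ (Fin n → Fin n → Fin n) λ Q →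
  LatinSquare Q
  × (∀ a b → rankM I a b ≡ Q a b)
  × (∀ a b → toℕ (rankW I b a) + toℕ (Q a b) + 1 ≡ n)

-- Auxiliary instance on suc n men/women: A embeds via inject₁, the new
-- man ã and new woman b̃ are both  fromℕ n  (the last index).
IsAuxiliary : ∀ {n} → Instance n → Instance (suc n) → Set
IsAuxiliary {n} I I' =
  (∀ a → rankM I' (inject₁ a) (fromℕ n) ≡ fromℕ n)
  × (∀ a b b' → (rankM I a b < rankM I a b' → rankM I' (inject₁ a) (inject₁ b) < rankM I' (inject₁ a) (inject₁ b'))
               × (rankM I' (inject₁ a) (inject₁ b) < rankM I' (inject₁ a) (inject₁ b') → rankM I a b < rankM I a b'))
  × (rankM I' (fromℕ n) (fromℕ n) ≡ fromℕ n)
  × (∀ b → toℕ (rankW I' (inject₁ b) (fromℕ n)) ≡ 1)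
  × (∀ b a a' → (rankW I b a < rankW I b a' → rankW I' (inject₁ b) (inject₁ a) < rankW I' (inject₁ b) (inject₁ a'))
               × (rankW I' (inject₁ b) (inject₁ a) < rankW I' (inject₁ b) (inject₁ a') → rankW I b a < rankW I b a'))
  × (rankW I' (fromℕ n) (fromℕ n) ≡ zero)

-- The set of stable matchings has exactly one element (matchings compared
-- extensionally by the partner function): M is stable and every stable
-- matching equals M.
UniqueStable : ∀ {k} → Instance k → Matching k → Set
UniqueStable {k} I M = Stable I M × (∀ M' → Stable I M' → ∀ a → partner M' a ≡ partner M a)

-- In a Latin instance the last woman σ(a) on a man a's list is exactly the woman who
-- ranks a first, and σ is a permutation.  In the auxiliary instance every woman of B
-- still ranks σ⁻¹ of herself first and b̃ ranks ã first, so matching a with σ(a) and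
-- ã with b̃ gives every woman her first choice, which is stable.  Conversely, a stable
-- matching never leaves a man preferring a woman who ranks him first.  So each a ∈ A
-- is matched inside B (he prefers σ(a) to b̃ and to being single), which by counting
-- forces ã onto b̃; then a woman of B matched below her first choice ranks ã, her
-- second choice, strictly higher, while ã prefers her to b̃.  Hence every woman is
-- matched to her first choice, i.e. each a ∈ A to σ(a), his second-to-last choice in
-- the auxiliary instance.
module Submission where

open import Defs
open import Data.Nat.Base as ℕ using (ℕ; suc; _+_; s≤s⁻¹)
import Data.Nat.Properties as ℕ
open import Data.Fin using (Fin; toℕ; inject₁; fromℕ; punchOut; _<_)
open import Data.Fin.Properties
  using (_≟_; any?; toℕ-injective; toℕ-fromℕ; toℕ-inject₁; fromℕ≢inject₁; inject₁-injective;
         toℕ<n; punchOut-injective; <⇒notInjective)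
open import Data.Fin.Relation.Unary.Top using (view; ‵fromℕ; ‵inject₁; view-inject₁)
open import Data.Maybe using (just; nothing)
open import Data.Maybe.Properties using (just-injective; ≡-dec)
open import Data.Product using (Σ; ∃; _×_; _,_; proj₁; proj₂)
open import Data.Sum using (inj₁; inj₂)
open import Data.Empty using (⊥-elim)
open import Function using (_∘_)
open import Function.Definitions using (Injective)
open import Relation.Nullary using (¬_; yes; no; contradiction)
open import Relation.Binary.PropositionalEquality

inject₁≢fromℕ : ∀ {n} {i : Fin n} → inject₁ i ≢ fromℕ n
inject₁≢fromℕ = fromℕ≢inject₁ ∘ sym

injective⇒surjective : ∀ {m} {f : Fin m → Fin m} → Injective _≡_ _≡_ f →
                       ∀ y → ∃ λ x → f x ≡ y
injective⇒surjective {suc m} {f} f-inj y with any? (λ x → f x ≟ y)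
... | yes hit = hit
... | no miss = ⊥-elim (<⇒notInjective (ℕ.n<1+n m) g-inj)
  where
  y≢f : ∀ x → y ≢ f x
  y≢f x y≡fx = miss (x , sym y≡fx)

  g : Fin (suc m) → Fin m
  g x = punchOut (y≢f x)

  g-inj : Injective _≡_ _≡_ g
  g-inj = f-inj ∘ punchOut-injective (y≢f _) (y≢f _)

last-rank-attained : ∀ {m} {r : Fin m → Fin m} → Injective _≡_ _≡_ r →
                     Fin m → ∃ λ x → suc (toℕ (r x)) ≡ m
last-rank-attained {suc m} r-inj _
  with x , r[x]≡m ← injective⇒surjective r-inj (fromℕ m)
  = x , cong suc (trans (cong toℕ r[x]≡m) (toℕ-fromℕ m))

Least : ∀ {A : Set} {m} → (A → Fin m) → A → Set
Least r x = ∀ y → y ≢ x → r x < r y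

Greatest : ∀ {A : Set} {m} → (A → Fin m) → A → Set
Greatest r x = ∀ y → y ≢ x → r y < r x

module _ {A : Set} {m : ℕ} {r : A → Fin m} (r-inj : Injective _≡_ _≡_ r) where

  toℕ≡0⇒least : ∀ {x} → toℕ (r x) ≡ 0 → Least r x
  toℕ≡0⇒least r[x]≡0 y y≢x = subst (ℕ._< toℕ (r y)) (sym r[x]≡0)
    (ℕ.n≢0⇒n>0 (λ r[y]≡0 → y≢x (r-inj (toℕ-injective (trans r[y]≡0 (sym r[x]≡0))))))

  last⇒greatest : ∀ {x} → suc (toℕ (r x)) ≡ m → Greatest r x
  last⇒greatest r[x]≡last y y≢x =
    ℕ.≤∧≢⇒< (s≤s⁻¹ (subst (toℕ (r y) ℕ.<_) (sym r[x]≡last) (toℕ<n (r y))))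
            (λ r[y]≡r[x] → y≢x (r-inj (toℕ-injective r[y]≡r[x])))

fromℕ⇒greatest : ∀ {A : Set} {n} {r : A → Fin (suc n)} → Injective _≡_ _≡_ r →
                 ∀ {x} → r x ≡ fromℕ n → Greatest r x
fromℕ⇒greatest {n = n} r-inj r[x]≡top =
  last⇒greatest r-inj (cong suc (trans (cong toℕ r[x]≡top) (toℕ-fromℕ n)))

least-unique : ∀ {k m} {r : Fin k → Fin m} {x y} → Least r x → Least r y → x ≡ y
least-unique {x = x} {y} x-least y-least with x ≟ y
... | yes x≡y = x≡y
... | no x≢y = contradiction (x-least y (x≢y ∘ sym)) (ℕ.<-asym (y-least x x≢y))

least⇒toℕ≡0 : ∀ {k} {r : Fin k → Fin k} → Injective _≡_ _≡_ r →
               ∀ {x} → Least r x → toℕ (r x) ≡ 0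
least⇒toℕ≡0 {suc k} r-inj x-least
  with x₀ , r[x₀]≡0 ← injective⇒surjective r-inj Fin.zero
  with refl ← least-unique (toℕ≡0⇒least r-inj (cong toℕ r[x₀]≡0)) x-least
  = cong toℕ r[x₀]≡0

least-mono : ∀ {A : Set} {m m'} {r : A → Fin m} {s : A → Fin m'} →
             (∀ y y' → r y < r y' → s y < s y') → ∀ {x} → Least r x → Least s x
least-mono r<⇒s< x-least y y≢x = r<⇒s< _ y (x-least y y≢x)

least-∘ : ∀ {A B : Set} {m} {r : B → Fin m} {g : A → B} → Injective _≡_ _≡_ g →
          ∀ {x} → Least r (g x) → Least (r ∘ g) x
least-∘ g-inj gx-least y y≢x = gx-least _ (y≢x ∘ g-inj)

least-below-second : ∀ {n} {r : Fin (suc n) → Fin (suc n)} → Injective _≡_ _≡_ r →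
                     toℕ (r (fromℕ n)) ≡ 1 → ∀ {a} → Least (r ∘ inject₁) a → Least r (inject₁ a)
least-below-second r-inj r[top]≡1 a-least
  with x₀ , r[x₀]≡0 ← injective⇒surjective r-inj Fin.zero
  with x₀-least ← toℕ≡0⇒least r-inj (cong toℕ r[x₀]≡0)
  with view x₀
... | ‵fromℕ = contradiction (trans (sym r[top]≡1) (cong toℕ r[x₀]≡0)) λ ()
... | ‵inject₁ a₀ with refl ← least-unique (least-∘ inject₁-injective x₀-least) a-least = x₀-least

greatest-below-last : ∀ {n} {r : Fin (suc n) → Fin (suc n)} → Injective _≡_ _≡_ r →
                      r (fromℕ n) ≡ fromℕ n → ∀ {b} → Greatest (r ∘ inject₁) b →
                      suc (toℕ (r (inject₁ b))) ≡ n
greatest-below-last {suc m} {r} r-inj r[top]≡top {b} b-greatest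
  with x , r[x]≡m ← injective⇒surjective r-inj (inject₁ (fromℕ m))
  with toℕ-r[x]≡m ← trans (cong toℕ r[x]≡m) (trans (toℕ-inject₁ (fromℕ m)) (toℕ-fromℕ m))
  with view x
... | ‵fromℕ = contradiction (trans (sym r[top]≡top) r[x]≡m) fromℕ≢inject₁
... | ‵inject₁ b' with b' ≟ b
...   | yes refl = cong suc toℕ-r[x]≡m
...   | no b'≢b = contradiction (s≤s⁻¹ r[b]<1+m) (ℕ.<⇒≱ m<r[b])
  where
  m<r[b] : m ℕ.< toℕ (r (inject₁ b))
  m<r[b] = subst (ℕ._< toℕ (r (inject₁ b))) toℕ-r[x]≡m (b-greatest b' b'≢b)

  r[b]<1+m : toℕ (r (inject₁ b)) ℕ.< suc m
  r[b]<1+m = subst (toℕ (r (inject₁ b)) ℕ.<_) (trans (cong toℕ r[top]≡top) (toℕ-fromℕ (suc m)))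
                   (fromℕ⇒greatest r-inj r[top]≡top (inject₁ b) inject₁≢fromℕ)

module _ {k} (I : Instance k) where

  prefers⇒≢partner : ∀ {M x y} → ManPrefers I M x y → partner M x ≢ just y
  prefers⇒≢partner (inj₁ unmatched) matched with () ← trans (sym unmatched) matched
  prefers⇒≢partner (inj₂ (y' , matched' , y<y')) matched
    with refl ← just-injective (trans (sym matched') matched) = ℕ.<-irrefl refl y<y'

  first-choice-prefers : ∀ {M x y} → Least (rankW I y) x → partner M x ≢ just y →
                         WomanPrefers I M x y
  first-choice-prefers {M} {x} {y} x-first x↛y
    with any? (λ x' → ≡-dec _≟_ (partner M x') (just y))
  ... | no unmatched = inj₁ (λ x' x'↦y → unmatched (x' , x'↦y))
  ... | yes (x' , x'↦y) = inj₂ (x' , x'↦y , x-first x' (λ { refl → x↛y x'↦y }))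

  stable⇒¬prefers-first-choice : ∀ {M x y} → Stable I M → Least (rankW I y) x →
                                 ¬ ManPrefers I M x y
  stable⇒¬prefers-first-choice {M} {x} {y} stable x-first prefers =
    stable x y (prefers , first-choice-prefers {M} x-first (prefers⇒≢partner {M} prefers))

module FirstChoiceMatching {k} (I : Instance k) (μ : Fin k → Fin k)
                           (μ-first : ∀ x → Least (rankW I (μ x)) x) where

  μ-injective : Injective _≡_ _≡_ μ
  μ-injective {x} {x'} μx≡μx' =
    least-unique (μ-first x) (subst (λ y → Least (rankW I y) x') (sym μx≡μx') (μ-first x'))

  matching : Matching k
  matching = record
    { partner     = just ∘ μ
    ; partner-inj = λ x x' y x↦y x'↦y → μ-injective (just-injective (trans x↦y (sym x'↦y)))
    }

  stable : Stable I matching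
  stable x y (_ , inj₁ unmatched) with x' , refl ← injective⇒surjective μ-injective y =
    unmatched x' refl
  stable x y (_ , inj₂ (x' , refl , x<x')) = ℕ.<-asym x<x' (μ-first x' x x≢x')
    where
    x≢x' : x ≢ x'
    x≢x' refl = ℕ.<-irrefl refl x<x'

module Auxiliary {n} (I : Instance n) (I' : Instance (suc n))
  (latin : ∀ a b → toℕ (rankW I b a) + suc (toℕ (rankM I a b)) ≡ n)
  (b̃-last : ∀ a → rankM I' (inject₁ a) (fromℕ n) ≡ fromℕ n)
  (rankM-mono : ∀ a b b' → rankM I a b < rankM I a b' →
                rankM I' (inject₁ a) (inject₁ b) < rankM I' (inject₁ a) (inject₁ b'))
  (ã-ranks-b̃-last : rankM I' (fromℕ n) (fromℕ n) ≡ fromℕ n)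
  (ã-second : ∀ b → toℕ (rankW I' (inject₁ b) (fromℕ n)) ≡ 1)
  (rankW-mono : ∀ b a a' → rankW I b a < rankW I b a' →
                rankW I' (inject₁ b) (inject₁ a) < rankW I' (inject₁ b) (inject₁ a'))
  (rankW-comono : ∀ b a a' → rankW I' (inject₁ b) (inject₁ a) < rankW I' (inject₁ b) (inject₁ a') →
                  rankW I b a < rankW I b a')
  (b̃-ranks-ã-first : rankW I' (fromℕ n) (fromℕ n) ≡ Fin.zero)
  where

  ã b̃ : Fin (suc n)
  ã = fromℕ n
  b̃ = fromℕ n

  last⇒first : ∀ {a b} → suc (toℕ (rankM I a b)) ≡ n → Least (rankW I b) a
  last⇒first {a} {b} last =
    toℕ≡0⇒least (rankW-inj I b) (ℕ.+-cancelʳ-≡ _ _ 0 (trans (latin a b) (sym last)))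

  first⇒last : ∀ {a b} → Least (rankW I b) a → suc (toℕ (rankM I a b)) ≡ n
  first⇒last {a} {b} a-first =
    subst (λ r → r + suc (toℕ (rankM I a b)) ≡ n) (least⇒toℕ≡0 (rankW-inj I b) a-first) (latin a b)

  σ : Fin n → Fin n
  σ a = proj₁ (last-rank-attained (rankM-inj I a) a)

  σ-last : ∀ a → suc (toℕ (rankM I a (σ a))) ≡ n
  σ-last a = proj₂ (last-rank-attained (rankM-inj I a) a)

  first-choice-lifts : ∀ {a b} → Least (rankW I b) a → Least (rankW I' (inject₁ b)) (inject₁ a)
  first-choice-lifts {b = b} =
    least-below-second (rankW-inj I' (inject₁ b)) (ã-second b) ∘ least-mono (rankW-mono b)

  first-choice-lowers : ∀ {a b} → Least (rankW I' (inject₁ b)) (inject₁ a) → Least (rankW I b) a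
  first-choice-lowers {b = b} = least-mono (rankW-comono b) ∘ least-∘ inject₁-injective

  σ-first : ∀ a → Least (rankW I' (inject₁ (σ a))) (inject₁ a)
  σ-first a = first-choice-lifts (last⇒first (σ-last a))

  ã-first : Least (rankW I' b̃) ã
  ã-first = toℕ≡0⇒least (rankW-inj I' b̃) (cong toℕ b̃-ranks-ã-first)

  prefers-to-b̃ : ∀ {x} → rankM I' x b̃ ≡ b̃ → ∀ b → rankM I' x (inject₁ b) < rankM I' x b̃
  prefers-to-b̃ r[b̃]≡b̃ b = fromℕ⇒greatest (rankM-inj I' _) r[b̃]≡b̃ (inject₁ b) inject₁≢fromℕ

  σ-second-last : ∀ a → suc (toℕ (rankM I' (inject₁ a) (inject₁ (σ a)))) ≡ n
  σ-second-last a = greatest-below-last (rankM-inj I' (inject₁ a)) (b̃-last a)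
    (λ b b≢σa → rankM-mono a b (σ a) (last⇒greatest (rankM-inj I a) (σ-last a) b b≢σa))

  μ : Fin (suc n) → Fin (suc n)
  μ x with view x
  ... | ‵fromℕ      = b̃
  ... | ‵inject₁ a = inject₁ (σ a)

  μ-first : ∀ x → Least (rankW I' (μ x)) x
  μ-first x with view x
  ... | ‵fromℕ      = ã-first
  ... | ‵inject₁ a = σ-first a

  open FirstChoiceMatching I' μ μ-first public using (matching; stable)

  men-second-last : ∀ a → Σ (Fin (suc n)) λ b →
                    partner matching (inject₁ a) ≡ just b × suc (toℕ (rankM I' (inject₁ a) b)) ≡ n
  men-second-last a rewrite view-inject₁ a = inject₁ (σ a) , refl , σ-second-last a

  module _ (M' : Matching (suc n)) (M'-stable : Stable I' M') where

    ¬prefers-first-choice : ∀ {x y} → Least (rankW I' y) x → ¬ ManPrefers I' M' x y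
    ¬prefers-first-choice = stable⇒¬prefers-first-choice I' {M'} M'-stable

    matched-in-B : ∀ a → ∃ λ b → partner M' (inject₁ a) ≡ just (inject₁ b)
    matched-in-B a with partner M' (inject₁ a) in a↦
    ... | nothing = contradiction (inj₁ a↦) (¬prefers-first-choice (σ-first a))
    ... | just y with view y
    ...   | ‵fromℕ =
      contradiction (inj₂ (b̃ , a↦ , prefers-to-b̃ (b̃-last a) (σ a))) (¬prefers-first-choice (σ-first a))
    ...   | ‵inject₁ b = b , refl

    spouse : Fin n → Fin n
    spouse a = proj₁ (matched-in-B a)

    a↦spouse : ∀ a → partner M' (inject₁ a) ≡ just (inject₁ (spouse a))
    a↦spouse a = proj₂ (matched-in-B a)

    spouse-injective : Injective _≡_ _≡_ spouse
    spouse-injective {a} {a'} spouse≡ = inject₁-injective (partner-inj M' _ _ _ (a↦spouse a)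
      (subst (λ b → partner M' (inject₁ a') ≡ just (inject₁ b)) (sym spouse≡) (a↦spouse a')))

    ã↦b̃ : partner M' ã ≡ just b̃
    ã↦b̃ with partner M' ã in ã↦
    ... | nothing = contradiction (inj₁ ã↦) (¬prefers-first-choice ã-first)
    ... | just y with view y
    ...   | ‵fromℕ = refl
    ...   | ‵inject₁ b with a , refl ← injective⇒surjective spouse-injective b =
      contradiction (partner-inj M' _ _ _ (a↦spouse a) ã↦) inject₁≢fromℕ

    spouse-first : ∀ a → Least (rankW I' (inject₁ (spouse a))) (inject₁ a)
    spouse-first a = toℕ≡0⇒least (rankW-inj I' (inject₁ (spouse a))) r[a]≡0
      where
      r : Fin (suc n) → Fin (suc n)
      r = rankW I' (inject₁ (spouse a))

      r[a]≡0 : toℕ (r (inject₁ a)) ≡ 0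
      r[a]≡0 with toℕ (r (inject₁ a)) in r[a]
      ... | 0 = refl
      ... | 1 = contradiction (rankW-inj I' _ (toℕ-injective (trans r[a] (sym (ã-second (spouse a))))))
                              inject₁≢fromℕ
      ... | suc (suc _) = ⊥-elim (M'-stable ã (inject₁ (spouse a)) (ã-prefers , prefers-ã))
        where
        ã-prefers : ManPrefers I' M' ã (inject₁ (spouse a))
        ã-prefers = inj₂ (b̃ , ã↦b̃ , prefers-to-b̃ ã-ranks-b̃-last (spouse a))

        prefers-ã : WomanPrefers I' M' ã (inject₁ (spouse a))
        prefers-ã = inj₂ (inject₁ a , a↦spouse a ,
                          subst₂ ℕ._<_ (sym (ã-second (spouse a))) (sym r[a]) (ℕ.s≤s (ℕ.s≤s ℕ.z≤n)))

    spouse≡σ : ∀ a → spouse a ≡ σ a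
    spouse≡σ a = rankM-inj I a (toℕ-injective (ℕ.suc-injective
      (trans (first⇒last (first-choice-lowers (spouse-first a))) (sym (σ-last a)))))

    unique : ∀ x → partner M' x ≡ partner matching x
    unique x with view x
    ... | ‵fromℕ      = ã↦b̃
    ... | ‵inject₁ a = trans (a↦spouse a) (cong (just ∘ inject₁) (spouse≡σ a))

latin-rank-sum : ∀ {n} {I : Instance n} → IsLatin I →
                 ∀ a b → toℕ (rankW I b a) + suc (toℕ (rankM I a b)) ≡ n
latin-rank-sum {n} {I} (Q , _ , rankM≡Q , rank-sum) a b = begin
  w + suc (toℕ (rankM I a b)) ≡⟨ cong (λ q → w + suc (toℕ q)) (rankM≡Q a b) ⟩
  w + suc (toℕ (Q a b))       ≡⟨ ℕ.+-suc w (toℕ (Q a b)) ⟩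
  suc (w + toℕ (Q a b))       ≡⟨ ℕ.+-comm 1 _ ⟩
  w + toℕ (Q a b) + 1         ≡⟨ rank-sum a b ⟩
  n                           ∎
  where
  open ≡-Reasoning

  w : ℕ
  w = toℕ (rankW I b a)

lemma12 : (n : ℕ) (I : Instance n) (I' : Instance (suc n)) →
    IsLatin I → IsAuxiliary I I' →
    Σ (Matching (suc n)) λ M → UniqueStable I' M
      × (∀ (a : Fin n) → Σ (Fin (suc n)) λ b →
           partner M (inject₁ a) ≡ just b × suc (toℕ (rankM I' (inject₁ a) b)) ≡ n)
lemma12 n I I' latin
        (b̃-last , rankM-order , ã-ranks-b̃-last , ã-second , rankW-order , b̃-ranks-ã-first) =
  matching , (stable , unique) , men-second-last
  where
  open Auxiliary I I' (latin-rank-sum {I = I} latin) b̃-last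
         (λ a b b' → proj₁ (rankM-order a b b')) ã-ranks-b̃-last ã-second
         (λ b a a' → proj₁ (rankW-order b a a')) (λ b a a' → proj₂ (rankW-order b a a'))
         b̃-ranks-ã-first
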